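{- Let $G=(V,E)$ be a connected block graph. Then $rad(G)\leq \alpha_{\min}(G)$.
   Context: All graphs are finite, simple and undirected. A block of a graph is a maximal 2-connected subgraph; $G$ is a block graph if every block of $G$ is a complete graph (clique). For a connected graph, $d(u,v)$ is the length of a shortest $u$–$v$ path, $\epsilon_G(u)=\max_{v\in V}d(u,v)$ is the eccentricity of $u$, and $rad(G)=\min_{v\in V}\epsilon_G(v)$ is the radius. For a vertex $v$, $\alpha(G,v)$ denotes the maximum size of an independent set of $G$ containing $v$, and $\alpha_{\min}(G)=\min_{v\in V(G)}\alpha(G,v)$. -}

module Defs where

open import Data.Nat using (ℕ; zero; suc; _≤_)
open import Data.Fin using (Fin)
open import Data.Fin.Subset using (Subset; _∈_; _⊆_; ∣_∣)
open import Data.Product using (Σ; ∃; _×_; _,_)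
open import Relation.Nullary using (¬_)
open import Relation.Binary.PropositionalEquality using (_≡_)

record Graph (n : ℕ) : Set₁ where
  field
    Adj   : Fin n → Fin n → Set
    sym   : ∀ {u v} → Adj u v → Adj v u
    irref : ∀ {u} → ¬ Adj u u
open Graph public

module _ {n : ℕ} (G : Graph n) where

  data Walk : Fin n → Fin n → ℕ → Set where
    here : ∀ {u} → Walk u u zero
    step : ∀ {u v w k} → Adj G u v → Walk v w k → Walk u w (suc k)

  Connected : Set
  Connected = ∀ u v → ∃ λ k → Walk u v k

  IsDist : Fin n → Fin n → ℕ → Set
  IsDist u v d = Walk u v d × (∀ k → Walk u v k → d ≤ k)

  IsEcc : Fin n → ℕ → Set
  IsEcc u e = (∃ λ v → IsDist u v e) × (∀ v d → IsDist u v d → d ≤ e)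

  IsRad : ℕ → Set
  IsRad r = (∃ λ u → IsEcc u r) × (∀ u e → IsEcc u e → r ≤ e)

  Independent : Subset n → Set
  Independent S = ∀ x y → x ∈ S → y ∈ S → ¬ Adj G x y

  IsAlphaAt : Fin n → ℕ → Set
  IsAlphaAt v a =
    (∃ λ S → Independent S × v ∈ S × ∣ S ∣ ≡ a) ×
    (∀ S → Independent S → v ∈ S → ∣ S ∣ ≤ a)

  IsAlphaMin : ℕ → Set
  IsAlphaMin m = (∃ λ v → IsAlphaAt v m) × (∀ v a → IsAlphaAt v a → m ≤ a)

  data WalkIn (P : Fin n → Set) : Fin n → Fin n → Set where
    here : ∀ {u} → P u → WalkIn P u u
    step : ∀ {u v w} → P u → Adj G u v → WalkIn P v w → WalkIn P u w

  ConnectedOn : (Fin n → Set) → Set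
  ConnectedOn P = ∀ u v → P u → P v → WalkIn P u v

  -- G[B] is nonempty, connected and has no cut vertex
  -- (i.e. G[B] is K1, K2, or 2-connected)
  Nonseparable : Subset n → Set
  Nonseparable B =
    (∃ λ x → x ∈ B) ×
    ConnectedOn (λ y → y ∈ B) ×
    (∀ x → x ∈ B → ConnectedOn (λ y → y ∈ B × ¬ (y ≡ x)))

  IsBlock : Subset n → Set
  IsBlock B = Nonseparable B × (∀ C → Nonseparable C → B ⊆ C → C ⊆ B)

  IsClique : Subset n → Set
  IsClique B = ∀ x y → x ∈ B → y ∈ B → ¬ (x ≡ y) → Adj G x y

  IsBlockGraph : Set
  IsBlockGraph = ∀ B → IsBlock B → IsClique B

-- Let D be the diameter of G, realised by a geodesic p₀ … p_D.  In a block graph every interior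
-- vertex p_k of a geodesic separates p₀ from p_D: otherwise a shortest p_{k-1}–p_{k+1} path
-- avoiding p_k closes a cycle through p_k, the cycle lies in a block, the block is a clique,
-- and p_{k-1} ~ p_{k+1} contradicts the geodesic.  Hence every vertex reaches p_{⌈D/2⌉} within
-- ⌈D/2⌉ steps on its way to p₀ or p_D, so rad(G) ≤ ⌈D/2⌉.  On the other hand the closed
-- neighbourhood of any vertex v meets the geodesic in at most three consecutive vertices, and v
-- together with every second geodesic vertex outside them is an independent set of size at
-- least ⌈D/2⌉, so α(G,v) ≥ ⌈D/2⌉.
module Submission where

open import Defs
open import Data.Empty using (⊥-elim)
open import Data.Fin using (Fin) renaming (zero to fzero; suc to fsuc)
open import Data.Fin.Properties using () renaming (_≟_ to _≟ᶠ_)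
open import Data.Fin.Subset using (Subset; _∈_; _⊆_; ∣_∣; ⁅_⁆; _∪_) renaming (⊥ to ∅)
open import Data.Fin.Subset.Properties
  using (_∈?_; x∈⁅x⁆; x∈⁅y⁆⇒x≡y; x∈p∪q⁻; x∈p∪q⁺; ∉⊥; q⊆p∪q; p⊂q⇒∣p∣<∣q∣; ∣p∣≤n)
open import Data.List using (List; []; _∷_; _++_; length; map; foldr; applyUpTo)
open import Data.List.Properties using (length-map; length-++)
open import Data.List.Membership.Propositional using () renaming (_∈_ to _∈ₗ_)
open import Data.List.Membership.Propositional.Properties using (∈-applyUpTo⁺; ∈-applyUpTo⁻)
open import Data.List.Relation.Unary.Any using (here; there)
open import Data.List.Relation.Unary.All as All using (All; []; _∷_)
import Data.List.Relation.Unary.All.Properties as All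
open import Data.List.Relation.Unary.AllPairs as AllPairs using (AllPairs; []; _∷_)
import Data.List.Relation.Unary.AllPairs.Properties as AllPairs
open import Data.Nat
  using (ℕ; zero; suc; _+_; _∸_; _≤_; _<_; z≤n; s≤s; z<s; s<s; _≤?_; _⊔_; ⌈_/2⌉; ⌊_/2⌋)
open import Data.Nat.Induction using (<-rec)
open import Data.Nat.Properties
open import Data.Product using (∃; ∃₂; _×_; _,_; proj₁; proj₂)
open import Data.Sum using (_⊎_; inj₁; inj₂)
open import Data.Unit using (⊤; tt)
open import Effect.Monad using (RawMonad)
open import Function using (_∘_)
open import Level using (0ℓ)
open import Relation.Binary using (tri<; tri≈; tri>)
open import Relation.Binary.PropositionalEquality as ≡ using (_≡_; _≢_; refl; subst; cong)
open import Relation.Nullary using (¬_; yes; no)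
open import Relation.Nullary.Decidable using (¬¬-excluded-middle; decidable-stable)
open import Relation.Nullary.Negation using (¬¬-Monad)

-- Adjacency is an arbitrary type, so blocks, distances and eccentricities are only found
-- classically: the argument runs in the double-negation monad, which is harmless because the
-- conclusion r ≤ m is decidable.
open RawMonad (¬¬-Monad {0ℓ}) using (return; _>>=_)

¬¬-least : (P : ℕ → Set) → ∀ k → P k → ¬ ¬ (∃ λ e → P e × (∀ j → j < e → ¬ P j))
¬¬-least P = <-rec _ λ k smaller Pk → do
  yes (j , j<k , Pj) ← ¬¬-excluded-middle {A = ∃ λ j → j < k × P j}
    where no none → return (k , Pk , λ j j<k Pj → none (j , j<k , Pj))
  smaller j<k Pj

¬¬-∀-Fin : ∀ {m} {P : Fin m → Set} → (∀ i → ¬ ¬ P i) → ¬ ¬ (∀ i → P i)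
¬¬-∀-Fin {zero} _ = return λ ()
¬¬-∀-Fin {suc m} ¬¬P = do
  P₀ ← ¬¬P fzero
  P₊ ← ¬¬-∀-Fin (λ i → ¬¬P (fsuc i))
  return λ where fzero → P₀ ; (fsuc i) → P₊ i

¬¬-∃¬ : ∀ {m} {P : Fin m → Set} → ¬ (∀ i → P i) → ¬ ¬ (∃ λ i → ¬ P i)
¬¬-∃¬ ¬∀ ¬∃ = ¬¬-∀-Fin (λ i ¬Pi → ¬∃ (i , ¬Pi)) ¬∀

Fin-uniform-bound : ∀ {m} (P : Fin m → ℕ → Set) → (∀ i {j k} → j ≤ k → P i j → P i k) →
  (∀ i → ∃ (P i)) → ∃ λ K → ∀ i → P i K
Fin-uniform-bound {zero} P mono bounded = 0 , λ ()
Fin-uniform-bound {suc m} P mono bounded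
  with bounded fzero | Fin-uniform-bound (P ∘ fsuc) (mono ∘ fsuc) (bounded ∘ fsuc)
... | k , P₀k | K , P₊K = k ⊔ K , λ where
  fzero → mono fzero (m≤m⊔n k K) P₀k
  (fsuc i) → mono (fsuc i) (m≤n⊔m k K) (P₊K i)

⌈1+n/2⌉≤1+⌈n/2⌉ : ∀ n → ⌈ suc n /2⌉ ≤ suc ⌈ n /2⌉
⌈1+n/2⌉≤1+⌈n/2⌉ n = s≤s (⌊n/2⌋-mono (n≤1+n n))

n≤⌈n/2⌉+⌈n/2⌉ : ∀ n → n ≤ ⌈ n /2⌉ + ⌈ n /2⌉
n≤⌈n/2⌉+⌈n/2⌉ n = begin
  n                  ≡⟨ ≡.sym (⌊n/2⌋+⌈n/2⌉≡n n) ⟩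
  ⌊ n /2⌋ + ⌈ n /2⌉  ≤⟨ +-monoˡ-≤ ⌈ n /2⌉ (⌊n/2⌋≤⌈n/2⌉ n) ⟩
  ⌈ n /2⌉ + ⌈ n /2⌉  ∎
  where open ≤-Reasoning

⌈n/2⌉-around-window : ∀ t D → t ≤ suc D → ⌈ D /2⌉ ≤ suc (⌈ t /2⌉ + ⌈ suc D ∸ (3 + t) /2⌉)
⌈n/2⌉-around-window zero zero _ = z≤n
⌈n/2⌉-around-window zero (suc zero) _ = s≤s z≤n
⌈n/2⌉-around-window zero (suc (suc D)) _ = ≤-refl
⌈n/2⌉-around-window (suc zero) zero _ = z≤n
⌈n/2⌉-around-window (suc zero) (suc zero) _ = s≤s z≤n
⌈n/2⌉-around-window (suc zero) (suc (suc zero)) _ = s≤s z≤n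
⌈n/2⌉-around-window (suc zero) (suc (suc (suc D))) _ = s≤s (⌈1+n/2⌉≤1+⌈n/2⌉ D)
⌈n/2⌉-around-window (suc (suc t)) zero (s≤s ())
⌈n/2⌉-around-window (suc (suc t)) (suc zero) _ = s≤s z≤n
⌈n/2⌉-around-window (suc (suc t)) (suc (suc D)) (s≤s (s≤s t≤D)) = s≤s (⌈n/2⌉-around-window t D t≤D)

a≤x<a+[s∸a]⇒x<s : ∀ {a x s} → a ≤ x → x < a + (s ∸ a) → x < s
a≤x<a+[s∸a]⇒x<s {a} {x} {s} a≤x x< with a ≤? s
... | yes a≤s = subst (x <_) (m+[n∸m]≡n a≤s) x<
... | no a≰s = ⊥-elim (<⇒≱ (subst (x <_) a+[s∸a]≡a x<) a≤x)
  where
  a+[s∸a]≡a : a + (s ∸ a) ≡ a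
  a+[s∸a]≡a = ≡.trans (cong (a +_) (m≤n⇒m∸n≡0 (<⇒≤ (≰⇒> a≰s)))) (+-identityʳ a)

everyOther : ℕ → ℕ → List ℕ
everyOther a zero = []
everyOther a (suc zero) = a ∷ []
everyOther a (suc (suc l)) = a ∷ everyOther (2 + a) l

length-everyOther : ∀ a l → length (everyOther a l) ≡ ⌈ l /2⌉
length-everyOther a zero = refl
length-everyOther a (suc zero) = refl
length-everyOther a (suc (suc l)) = cong suc (length-everyOther (2 + a) l)

everyOther-range : ∀ a l → All (λ i → a ≤ i × i < a + l) (everyOther a l)
everyOther-range a zero = []
everyOther-range a (suc zero) = (≤-refl , m<m+n a z<s) ∷ []
everyOther-range a (suc (suc l)) = (≤-refl , m<m+n a z<s) ∷
  All.map (λ (2+a≤i , i<) → ≤-trans (m≤n+m a 2) 2+a≤i , ≤-trans i< (≤-reflexive 2+a+l≡a+[2+l]))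
    (everyOther-range (2 + a) l)
  where
  2+a+l≡a+[2+l] : 2 + a + l ≡ a + (2 + l)
  2+a+l≡a+[2+l] = ≡.sym (≡.trans (+-suc a (suc l)) (cong suc (+-suc a l)))

everyOther-spaced : ∀ a l → AllPairs (λ i j → 2 + i ≤ j) (everyOther a l)
everyOther-spaced a zero = []
everyOther-spaced a (suc zero) = [] ∷ []
everyOther-spaced a (suc (suc l)) = All.map proj₁ (everyOther-range (2 + a) l) ∷ everyOther-spaced (2 + a) l

everyOtherOutside : ℕ → ℕ → List ℕ
everyOtherOutside t D = everyOther 0 t ++ everyOther (3 + t) (suc D ∸ (3 + t))

module _ {t D : ℕ} where

  everyOtherOutside-range : t ≤ suc D → All (λ i → i ≤ D × (i < t ⊎ 3 + t ≤ i)) (everyOtherOutside t D)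
  everyOtherOutside-range t≤1+D = All.++⁺
    (All.map (λ (_ , i<t) → ≤-pred (≤-trans i<t t≤1+D) , inj₁ i<t) (everyOther-range 0 t))
    (All.map (λ (3+t≤i , i<) → ≤-pred (a≤x<a+[s∸a]⇒x<s 3+t≤i i<) , inj₂ 3+t≤i)
             (everyOther-range (3 + t) _))

  everyOtherOutside-spaced : AllPairs (λ i j → 2 + i ≤ j) (everyOtherOutside t D)
  everyOtherOutside-spaced = AllPairs.++⁺ (everyOther-spaced 0 t) (everyOther-spaced (3 + t) _)
    (All.map (λ (_ , i<t) → All.map (λ (3+t≤j , _) → ≤-trans (s≤s i<t) (≤-trans (m≤n+m (suc t) 2) 3+t≤j))
                                     (everyOther-range (3 + t) _))
             (everyOther-range 0 t))

  ⌈D/2⌉≤1+length-everyOtherOutside : t ≤ suc D → ⌈ D /2⌉ ≤ suc (length (everyOtherOutside t D))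
  ⌈D/2⌉≤1+length-everyOtherOutside t≤1+D = begin
    ⌈ D /2⌉                                ≤⟨ ⌈n/2⌉-around-window t D t≤1+D ⟩
    suc (⌈ t /2⌉ + ⌈ suc D ∸ (3 + t) /2⌉)  ≡⟨ cong suc length-halves ⟩
    suc (length (everyOtherOutside t D))   ∎
    where
    open ≤-Reasoning
    length-halves : ⌈ t /2⌉ + ⌈ suc D ∸ (3 + t) /2⌉ ≡ length (everyOtherOutside t D)
    length-halves = ≡.sym (≡.trans (length-++ (everyOther 0 t))
      (≡.cong₂ _+_ (length-everyOther 0 t) (length-everyOther (3 + t) _)))

module _ {A : Set} {R : A → A → Set} where

  AllPairs-∈ : ∀ {xs x y} → AllPairs R xs → x ∈ₗ xs → y ∈ₗ xs → x ≡ y ⊎ R x y ⊎ R y x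
  AllPairs-∈ (_ ∷ _) (here refl) (here refl) = inj₁ refl
  AllPairs-∈ (Rx ∷ _) (here refl) (there y∈) = inj₂ (inj₁ (All.lookup Rx y∈))
  AllPairs-∈ (Rx ∷ _) (there x∈) (here refl) = inj₂ (inj₂ (All.lookup Rx x∈))
  AllPairs-∈ (_ ∷ Rxs) (there x∈) (there y∈) = AllPairs-∈ Rxs x∈ y∈

  AllPairs-withʳ : ∀ {Q : A → Set} {xs} → AllPairs R xs → All Q xs → AllPairs (λ x y → R x y × Q y) xs
  AllPairs-withʳ [] [] = []
  AllPairs-withʳ (Rx ∷ Rxs) (_ ∷ Qxs) = All.zip (Rx , Qxs) ∷ AllPairs-withʳ Rxs Qxs

module _ {n : ℕ} where

  fromList : List (Fin n) → Subset n
  fromList = foldr (λ x S → ⁅ x ⁆ ∪ S) ∅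

  ∈-fromList⁺ : ∀ {x} xs → x ∈ₗ xs → x ∈ fromList xs
  ∈-fromList⁺ (y ∷ ys) (here refl) = x∈p∪q⁺ (inj₁ (x∈⁅x⁆ y))
  ∈-fromList⁺ (y ∷ ys) (there x∈) = x∈p∪q⁺ (inj₂ (∈-fromList⁺ ys x∈))

  ∈-fromList⁻ : ∀ {x} xs → x ∈ fromList xs → x ∈ₗ xs
  ∈-fromList⁻ [] x∈ = ⊥-elim (∉⊥ x∈)
  ∈-fromList⁻ (y ∷ ys) x∈ with x∈p∪q⁻ ⁅ y ⁆ (fromList ys) x∈
  ... | inj₁ x∈⁅y⁆ = here (x∈⁅y⁆⇒x≡y y x∈⁅y⁆)
  ... | inj₂ x∈ys = there (∈-fromList⁻ ys x∈ys)

  length≤∣fromList∣ : ∀ {xs} → AllPairs _≢_ xs → length xs ≤ ∣ fromList xs ∣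
  length≤∣fromList∣ [] = z≤n
  length≤∣fromList∣ {x ∷ xs} (x∉ ∷ distinct) = ≤-trans (s≤s (length≤∣fromList∣ distinct))
    (p⊂q⇒∣p∣<∣q∣ (q⊆p∪q ⁅ x ⁆ (fromList xs) , x , x∈p∪q⁺ (inj₁ (x∈⁅x⁆ x)) ,
                  λ x∈xs → All.All¬⇒¬Any x∉ (∈-fromList⁻ xs x∈xs)))

module _ {n : ℕ} (G : Graph n) where

  data WalkWithin (P : Fin n → Set) : Fin n → Fin n → ℕ → Set where
    here : ∀ {u} → P u → WalkWithin P u u 0
    step : ∀ {u v w k} → P u → Adj G u v → WalkWithin P v w k → WalkWithin P u w (suc k)

  module _ {P : Fin n → Set} where

    infixr 5 _++ʷ_
    _++ʷ_ : ∀ {u v w k l} → WalkWithin P u v k → WalkWithin P v w l → WalkWithin P u w (k + l)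
    here _ ++ʷ w′ = w′
    step Pu uv w ++ʷ w′ = step Pu uv (w ++ʷ w′)

    snocʷ : ∀ {u v w k} → WalkWithin P u v k → Adj G v w → P w → WalkWithin P u w (suc k)
    snocʷ (here Pu) uw Pw = step Pu uw (here Pw)
    snocʷ (step Pu uv w) vw Pw = step Pu uv (snocʷ w vw Pw)

    reverseʷ : ∀ {u v k} → WalkWithin P u v k → WalkWithin P v u k
    reverseʷ (here Pu) = here Pu
    reverseʷ (step Pu uv w) = snocʷ (reverseʷ w) (sym G uv) Pu

    startsIn : ∀ {u v k} → WalkWithin P u v k → P u
    startsIn (here Pu) = Pu
    startsIn (step Pu _ _) = Pu

    endsIn : ∀ {u v k} → WalkWithin P u v k → P v
    endsIn (here Pv) = Pv
    endsIn (step _ _ w) = endsIn w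

    toWalk : ∀ {u v k} → WalkWithin P u v k → Walk G u v k
    toWalk (here _) = here
    toWalk (step _ uv w) = step uv (toWalk w)

    toWalkIn : ∀ {u v k} → WalkWithin P u v k → WalkIn G P u v
    toWalkIn (here Pu) = here Pu
    toWalkIn (step Pu uv w) = step Pu uv (toWalkIn w)

    fromWalkIn : ∀ {u v} → WalkIn G P u v → ∃ (WalkWithin P u v)
    fromWalkIn (here Pu) = 0 , here Pu
    fromWalkIn (step Pu uv w) with fromWalkIn w
    ... | k , w′ = suc k , step Pu uv w′

    vertices : ∀ {u v k} → WalkWithin P u v k → ℕ → Fin n
    vertices (here {u} _) _ = u
    vertices (step {u} _ _ _) zero = u
    vertices (step _ _ w) (suc i) = vertices w i

    vertices-first : ∀ {u v k} (w : WalkWithin P u v k) → vertices w 0 ≡ u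
    vertices-first (here _) = refl
    vertices-first (step _ _ _) = refl

    vertices-last : ∀ {u v k} (w : WalkWithin P u v k) → vertices w k ≡ v
    vertices-last (here _) = refl
    vertices-last (step _ _ w) = vertices-last w

    vertices-∈ : ∀ {u v k} (w : WalkWithin P u v k) → ∀ i → i ≤ k → P (vertices w i)
    vertices-∈ (here Pu) _ _ = Pu
    vertices-∈ (step Pu _ _) zero _ = Pu
    vertices-∈ (step _ _ w) (suc i) (s≤s i≤k) = vertices-∈ w i i≤k

    vertices-adj : ∀ {u v k} (w : WalkWithin P u v k) → ∀ i → i < k →
                   Adj G (vertices w i) (vertices w (suc i))
    vertices-adj (step _ uv w) zero _ = subst (Adj G _) (≡.sym (vertices-first w)) uv
    vertices-adj (step _ _ w) (suc i) (s<s i<k) = vertices-adj w i i<k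

    retag : ∀ {Q u v k} (w : WalkWithin P u v k) → (∀ i → i ≤ k → Q (vertices w i)) → WalkWithin Q u v k
    retag (here _) Q-w = here (Q-w 0 z≤n)
    retag (step _ uv w) Q-w = step (Q-w 0 z≤n) uv (retag w (λ i i≤k → Q-w (suc i) (s≤s i≤k)))

    takeʷ : ∀ {Q u v k} (w : WalkWithin P u v k) i → i ≤ k → (∀ j → j ≤ i → Q (vertices w j)) →
            WalkWithin Q u (vertices w i) i
    takeʷ (here _) zero _ Q-w = here (Q-w 0 z≤n)
    takeʷ (step _ _ _) zero _ Q-w = here (Q-w 0 z≤n)
    takeʷ (step _ uv w) (suc i) (s≤s i≤k) Q-w =
      step (Q-w 0 z≤n) uv (takeʷ w i i≤k (λ j j≤i → Q-w (suc j) (s≤s j≤i)))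

    dropʷ : ∀ {Q u v k} (w : WalkWithin P u v k) i → i ≤ k → (∀ j → i ≤ j → j ≤ k → Q (vertices w j)) →
            WalkWithin Q (vertices w i) v (k ∸ i)
    dropʷ (here _) zero _ Q-w = here (Q-w 0 z≤n z≤n)
    dropʷ w@(step _ _ _) zero _ Q-w = retag w (λ j j≤k → Q-w j z≤n j≤k)
    dropʷ (step _ _ w) (suc i) (s≤s i≤k) Q-w =
      dropʷ w i i≤k (λ j i≤j j≤k → Q-w (suc j) (s≤s i≤j) (s≤s j≤k))

  fromWalk : ∀ {u v k} → Walk G u v k → WalkWithin (λ _ → ⊤) u v k
  fromWalk here = here tt
  fromWalk (step uv w) = step tt uv (fromWalk w)

  reverseWalk : ∀ {u v k} → Walk G u v k → Walk G v u k
  reverseWalk w = toWalk (reverseʷ (fromWalk w))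

  avoid-or-visit : ∀ c {u v k} → Walk G u v k →
    WalkWithin (_≢ c) u v k ⊎ ∃₂ λ k₁ k₂ → Walk G u c k₁ × Walk G c v k₂ × k₁ + k₂ ≡ k
  avoid-or-visit c (here {u}) with u ≟ᶠ c
  ... | yes refl = inj₂ (0 , 0 , here , here , refl)
  ... | no u≢c = inj₁ (here u≢c)
  avoid-or-visit c (step {u} {k = k} uv w) with u ≟ᶠ c
  ... | yes refl = inj₂ (0 , suc k , here , step uv w , refl)
  ... | no u≢c with avoid-or-visit c w
  ...   | inj₁ w′ = inj₁ (step u≢c uv w′)
  ...   | inj₂ (k₁ , k₂ , v→c , c→w , k₁+k₂≡k) =
    inj₂ (suc k₁ , k₂ , step uv v→c , c→w , cong suc k₁+k₂≡k)

  connectedOn-hub : ∀ {P} h → (∀ u → P u → WalkIn G P u h) → ConnectedOn G P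
  connectedOn-hub h to-h u v Pu Pv with fromWalkIn (to-h u Pu) | fromWalkIn (to-h v Pv)
  ... | _ , u→h | _ , v→h = toWalkIn (u→h ++ʷ reverseʷ v→h)

  shortest-injective : ∀ {P u v q} (w : WalkWithin P u v q) → (∀ j → j < q → ¬ WalkWithin P u v j) →
    ∀ {i j} → i < j → j ≤ q → vertices w i ≢ vertices w j
  shortest-injective {P} {q = q} w shortest {i} {j} i<j j≤q wi≡wj = shortest (i + (q ∸ j)) shortcut<q shortcut
    where
    i≤q = ≤-trans (<⇒≤ i<j) j≤q
    shortcut = takeʷ w i i≤q (λ l l≤i → vertices-∈ w l (≤-trans l≤i i≤q)) ++ʷ
               subst (λ x → WalkWithin P x _ (q ∸ j)) (≡.sym wi≡wj)
                     (dropʷ w j j≤q (λ l _ l≤q → vertices-∈ w l l≤q))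
    shortcut<q : i + (q ∸ j) < q
    shortcut<q = begin-strict
      i + (q ∸ j)  <⟨ +-monoˡ-< (q ∸ j) i<j ⟩
      j + (q ∸ j)  ≡⟨ m+[n∸m]≡n j≤q ⟩
      q            ∎
      where open ≤-Reasoning

  Reach : ℕ → Fin n → Fin n → Set
  Reach K u v = ∃ λ k → k ≤ K × Walk G u v k

  Reach-mono : ∀ {j k u v} → j ≤ k → Reach j u v → Reach k u v
  Reach-mono j≤k (l , l≤j , w) = l , ≤-trans l≤j j≤k , w

  Reach-sym : ∀ {K u v} → Reach K u v → Reach K v u
  Reach-sym (k , k≤K , w) = k , k≤K , reverseWalk w

  Reach-trans : ∀ {J K u v w} → Reach J u v → Reach K v w → Reach (J + K) u w
  Reach-trans (j , j≤J , w) (k , k≤K , w′) =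
    j + k , +-mono-≤ j≤J k≤K , toWalk (fromWalk w ++ʷ fromWalk w′)

  exact-distance : ∀ {e u v} → Reach (suc e) u v → ¬ Reach e u v → IsDist G u v (suc e)
  exact-distance {e} {u} {v} (k , k≤1+e , w) far = subst (Walk G u v) (≤-antisym k≤1+e (longer k w)) w , longer
    where
    longer : ∀ k → Walk G u v k → suc e ≤ k
    longer k w = ≰⇒> λ k≤e → far (k , k≤e , w)

  distance≤ : ∀ {K u v d} → Reach K u v → IsDist G u v d → d ≤ K
  distance≤ (k , k≤K , w) (_ , shortest) = ≤-trans (shortest k w) k≤K

  eccentricity-within : ∀ c h → (∀ y → Reach h c y) → ¬ ¬ (∃ λ e → e ≤ h × IsEcc G c e)
  eccentricity-within c h reach = do
    (e , reach-e , smaller) ← ¬¬-least (λ e → ∀ y → Reach e c y) h reach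
    (y , farthest) ← attained e reach-e smaller
    return (e , ≮⇒≥ (λ h<e → smaller h h<e reach) , (y , farthest) ,
            λ v d dist → distance≤ (reach-e v) dist)
    where
    attained : ∀ e → (∀ y → Reach e c y) → (∀ j → j < e → ¬ (∀ y → Reach j c y)) →
               ¬ ¬ (∃ λ y → IsDist G c y e)
    attained zero _ _ = return (c , here , λ _ _ → z≤n)
    attained (suc e) reach-e smaller = do
      (y , far) ← ¬¬-∃¬ (smaller e ≤-refl)
      return (y , exact-distance (reach-e y) far)

  connected⇒bounded : Connected G → ∃ λ K → ∀ u v → Reach K u v
  connected⇒bounded connected =
    Fin-uniform-bound (λ u K → ∀ v → Reach K u v) (λ u j≤k reach v → Reach-mono j≤k (reach v)) λ u →
      Fin-uniform-bound (λ v K → Reach K u v) (λ v → Reach-mono) λ v →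
        let (k , w) = connected u v in k , k , ≤-refl , w

  Diameter : ℕ → Set
  Diameter D = ∀ u v → Reach D u v

  diametral-pair : Connected G → Fin n → ¬ ¬ (∃ λ D → Diameter D × ∃₂ λ a b → IsDist G a b D)
  diametral-pair connected v = do
    (D , reach , smaller) ← ¬¬-least Diameter _ (proj₂ (connected⇒bounded connected))
    pair D reach smaller
    where
    pair : ∀ D → Diameter D → (∀ j → j < D → ¬ Diameter j) →
           ¬ ¬ (∃ λ D → Diameter D × ∃₂ λ a b → IsDist G a b D)
    pair zero reach _ = return (0 , reach , v , v , here , λ _ _ → z≤n)
    pair (suc D) reach smaller = do
      (a , a-far) ← ¬¬-∃¬ (smaller D ≤-refl)
      (b , far) ← ¬¬-∃¬ a-far
      return (suc D , reach , a , b , exact-distance (reach a b) far)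

  record Geodesic (D : ℕ) : Set where
    field
      start end : Fin n
      walk : WalkWithin (λ _ → ⊤) start end D
      shortest : ∀ {i j q} → i ≤ j → j ≤ D → Walk G (vertices walk i) (vertices walk j) q → j ∸ i ≤ q

    vertex : ℕ → Fin n
    vertex = vertices walk

    adjacent : ∀ {i} → i < D → Adj G (vertex i) (vertex (suc i))
    adjacent = vertices-adj walk _

    distinct : ∀ {i j} → i < j → j ≤ D → vertex i ≢ vertex j
    distinct i<j j≤D vi≡vj =
      <-irrefl refl (<-≤-trans (m<n⇒0<n∸m i<j)
                               (shortest (<⇒≤ i<j) j≤D (subst (λ x → Walk G _ x 0) vi≡vj here)))

    nonadjacent : ∀ {i j} → 2 + i ≤ j → j ≤ D → ¬ Adj G (vertex i) (vertex j)
    nonadjacent 2+i≤j j≤D vi~vj =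
      <-irrefl refl (≤-trans (m+n≤o⇒m≤o∸n 2 2+i≤j) (shortest (m+n≤o⇒n≤o 2 2+i≤j) j≤D (step vi~vj here)))

    from-start : ∀ {j q} → j ≤ D → Walk G start (vertex j) q → j ≤ q
    from-start {j} {q} j≤D w =
      shortest z≤n j≤D (subst (λ x → Walk G x (vertex j) q) (≡.sym (vertices-first walk)) w)

    to-end : ∀ {i q} → i ≤ D → Walk G (vertex i) end q → D ∸ i ≤ q
    to-end {i} {q} i≤D w =
      shortest i≤D ≤-refl (subst (λ x → Walk G (vertex i) x q) (≡.sym (vertices-last walk)) w)

  IsDist⇒Geodesic : ∀ {a b D} → IsDist G a b D → Geodesic D
  IsDist⇒Geodesic {a} {b} {D} (a→b , minimal) = record { start = a ; end = b ; walk = w ; shortest = shortest }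
    where
    w = fromWalk a→b
    shortest : ∀ {i j q} → i ≤ j → j ≤ D → Walk G (vertices w i) (vertices w j) q → j ∸ i ≤ q
    shortest {i} {j} {q} i≤j j≤D wi→wj = m≤n+o⇒m∸n≤o j i (+-cancelʳ-≤ (D ∸ j) j (i + q) (begin
      j + (D ∸ j)        ≡⟨ m+[n∸m]≡n j≤D ⟩
      D                  ≤⟨ minimal _ (toWalk through) ⟩
      i + (q + (D ∸ j))  ≡⟨ ≡.sym (+-assoc i q (D ∸ j)) ⟩
      i + q + (D ∸ j)    ∎))
      where
      open ≤-Reasoning
      through = takeʷ w i (≤-trans i≤j j≤D) (λ _ _ → tt) ++ʷ fromWalk wi→wj ++ʷ
                dropʷ w j j≤D (λ _ _ _ → tt)

  module _ {c x z q} (w : WalkWithin (_≢ c) x z q) where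

    cycleList : List (Fin n)
    cycleList = c ∷ applyUpTo (vertices w) (suc q)

    cycle : Subset n
    cycle = fromList cycleList

    ∈-cycle-centre : c ∈ cycle
    ∈-cycle-centre = ∈-fromList⁺ cycleList (here refl)

    ∈-cycle-vertices : ∀ {i} → i ≤ q → vertices w i ∈ cycle
    ∈-cycle-vertices i≤q = ∈-fromList⁺ cycleList (there (∈-applyUpTo⁺ (vertices w) (s≤s i≤q)))

    ∈-cycle-start : x ∈ cycle
    ∈-cycle-start = subst (_∈ cycle) (vertices-first w) (∈-cycle-vertices z≤n)

    ∈-cycle-end : z ∈ cycle
    ∈-cycle-end = subst (_∈ cycle) (vertices-last w) (∈-cycle-vertices ≤-refl)

    ∈-cycle⁻ : ∀ {y} → y ∈ cycle → y ≡ c ⊎ ∃ λ i → i ≤ q × y ≡ vertices w i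
    ∈-cycle⁻ y∈ with ∈-fromList⁻ cycleList y∈
    ... | here y≡c = inj₁ y≡c
    ... | there y∈ with ∈-applyUpTo⁻ (vertices w) y∈
    ...   | i , s≤s i≤q , y≡wi = inj₂ (i , i≤q , y≡wi)

    backward : ∀ {Q} l → l ≤ q → (∀ j → j ≤ l → Q (vertices w j)) → WalkWithin Q (vertices w l) x l
    backward l l≤q Q-w = reverseʷ (takeʷ w l l≤q Q-w)

    module _ (xc : Adj G x c) (zc : Adj G z c) where

      back-to-centre : ∀ {Q} l → l ≤ q → (∀ j → j ≤ l → Q (vertices w j)) → Q c →
                       WalkIn G Q (vertices w l) c
      back-to-centre l l≤q Q-w Qc = toWalkIn (snocʷ (backward l l≤q Q-w) xc Qc)

      forth-to-centre : ∀ {Q} l → l ≤ q → (∀ j → l ≤ j → j ≤ q → Q (vertices w j)) → Q c →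
                        WalkIn G Q (vertices w l) c
      forth-to-centre l l≤q Q-w Qc = toWalkIn (snocʷ (dropʷ w l l≤q Q-w) zc Qc)

  cycle-nonseparable : ∀ {c x z q} (w : WalkWithin (_≢ c) x z q) →
    (∀ {i j} → i < j → j ≤ q → vertices w i ≢ vertices w j) →
    Adj G x c → Adj G z c → Nonseparable G (cycle w)
  cycle-nonseparable {c} {x} {z} {q} w injective xc zc =
    (c , ∈-cycle-centre w) , connectedOn-hub c to-centre , without
    where
    f = vertices w

    to-centre : ∀ y → y ∈ cycle w → WalkIn G (_∈ cycle w) y c
    to-centre y y∈ with ∈-cycle⁻ w y∈
    ... | inj₁ refl = here (∈-cycle-centre w)
    ... | inj₂ (l , l≤q , refl) =
      back-to-centre w xc zc l l≤q (λ _ j≤l → ∈-cycle-vertices w (≤-trans j≤l l≤q)) (∈-cycle-centre w)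

    to-start : ∀ y → y ∈ cycle w × y ≢ c → WalkIn G (λ y → y ∈ cycle w × y ≢ c) y x
    to-start y (y∈ , y≢c) with ∈-cycle⁻ w y∈
    ... | inj₁ y≡c = ⊥-elim (y≢c y≡c)
    ... | inj₂ (l , l≤q , refl) = toWalkIn (backward w l l≤q λ j j≤l →
            ∈-cycle-vertices w (≤-trans j≤l l≤q) , vertices-∈ w j (≤-trans j≤l l≤q))

    centre-avoids : ∀ j → j ≤ q → c ∈ cycle w × c ≢ f j
    centre-avoids j j≤q = ∈-cycle-centre w , λ c≡fj → vertices-∈ w j j≤q (≡.sym c≡fj)

    to-centre-avoiding : ∀ j → j ≤ q → ∀ y → y ∈ cycle w × y ≢ f j →
                         WalkIn G (λ y → y ∈ cycle w × y ≢ f j) y c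
    to-centre-avoiding j j≤q y (y∈ , y≢fj) with ∈-cycle⁻ w y∈
    ... | inj₁ refl = here (centre-avoids j j≤q)
    ... | inj₂ (l , l≤q , refl) with <-cmp l j
    ...   | tri< l<j _ _ = back-to-centre w xc zc l l≤q
            (λ i i≤l → ∈-cycle-vertices w (≤-trans i≤l l≤q) , injective (≤-<-trans i≤l l<j) j≤q)
            (centre-avoids j j≤q)
    ...   | tri≈ _ refl _ = ⊥-elim (y≢fj refl)
    ...   | tri> _ _ j<l = forth-to-centre w xc zc l l≤q
            (λ i l≤i i≤q → ∈-cycle-vertices w i≤q ,
                           λ fi≡fj → injective (<-≤-trans j<l l≤i) i≤q (≡.sym fi≡fj))
            (centre-avoids j j≤q)

    without : ∀ u → u ∈ cycle w → ConnectedOn G (λ y → y ∈ cycle w × ¬ y ≡ u)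
    without u u∈ with ∈-cycle⁻ w u∈
    ... | inj₁ refl = connectedOn-hub x to-start
    ... | inj₂ (j , j≤q , refl) = connectedOn-hub c (to-centre-avoiding j j≤q)

  nonseparable⇒⊆block : ∀ B → Nonseparable G B → ¬ ¬ (∃ λ C → IsBlock G C × B ⊆ C)
  nonseparable⇒⊆block B nsB = do
    (_ , (C , nsC , B⊆C , refl) , larger) ←
      ¬¬-least Extension (n ∸ ∣ B ∣) (B , nsB , (λ x∈B → x∈B) , refl)
    return (C , (nsC , maximal C B⊆C larger) , λ {x} → B⊆C {x})
    where
    Extension : ℕ → Set
    Extension k = ∃ λ C → Nonseparable G C × B ⊆ C × n ∸ ∣ C ∣ ≡ k

    maximal : ∀ C → B ⊆ C → (∀ j → j < n ∸ ∣ C ∣ → ¬ Extension j) →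
              ∀ C′ → Nonseparable G C′ → C ⊆ C′ → C′ ⊆ C
    maximal C B⊆C larger C′ nsC′ C⊆C′ {x} x∈C′ with x ∈? C
    ... | yes x∈C = x∈C
    ... | no x∉C =
      ⊥-elim (larger (n ∸ ∣ C′ ∣) (∸-monoʳ-< ∣C∣<∣C′∣ (∣p∣≤n C′)) (C′ , nsC′ , B⊆C′ , refl))
      where
      ∣C∣<∣C′∣ = p⊂q⇒∣p∣<∣q∣ ((λ {y} → C⊆C′ {y}) , x , x∈C′ , x∉C)
      B⊆C′ : B ⊆ C′
      B⊆C′ y∈B = C⊆C′ (B⊆C y∈B)

  module _ (blockGraph : IsBlockGraph G) where

    detour⇒adjacent : ∀ {x c z q} → Adj G x c → Adj G z c → x ≢ z → WalkWithin (_≢ c) x z q →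
                      ¬ ¬ Adj G x z
    detour⇒adjacent {x} {c} {z} xc zc x≢z detour = do
      (_ , w , shortest) ← ¬¬-least (WalkWithin (_≢ c) x z) _ detour
      (C , C-block , cycle⊆C) ←
        nonseparable⇒⊆block (cycle w) (cycle-nonseparable w (shortest-injective w shortest) xc zc)
      return (blockGraph C C-block x z (cycle⊆C (∈-cycle-start w)) (cycle⊆C (∈-cycle-end w)) x≢z)

    module _ {D} (γ : Geodesic D) where
      open Geodesic γ
      open ≤-Reasoning hiding (start)

      geodesic-separates : ∀ {k q} → k ≤ D → ¬ WalkWithin (_≢ vertex k) start end q
      geodesic-separates {zero} _ w = startsIn w (≡.sym (vertices-first walk))
      geodesic-separates {suc k} k+1≤D w with m≤n⇒m<n∨m≡n k+1≤D
      ... | inj₂ refl = endsIn w (≡.sym (vertices-last walk))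
      ... | inj₁ k+2≤D = detour⇒adjacent xc zc x≢z detour (nonadjacent ≤-refl k+2≤D)
        where
        xc = adjacent k+1≤D
        zc = sym G (adjacent k+2≤D)
        x≢z = distinct (n≤1+n (suc k)) k+2≤D
        detour =
          reverseʷ (takeʷ walk k (<⇒≤ k+1≤D) (λ j j≤k → distinct (s≤s j≤k) k+1≤D)) ++ʷ w ++ʷ
          reverseʷ (dropʷ walk (2 + k) k+2≤D (λ j k+2≤j j≤D vj≡c → distinct k+2≤j j≤D (≡.sym vj≡c)))

      private
        h : ℕ
        h = ⌈ D /2⌉

        h≤D : h ≤ D
        h≤D = ⌈n/2⌉≤n D

      midpoint-reaches : Diameter D → ∀ y → Reach ⌈ D /2⌉ (vertex ⌈ D /2⌉) y
      midpoint-reaches reach y with reach y start | reach y end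
      ... | _ , y→a≤D , y→a | _ , y→b≤D , y→b
          with avoid-or-visit (vertex h) y→a | avoid-or-visit (vertex h) y→b
      ... | inj₂ (k₁ , k₂ , y→c , c→a , refl) | _ =
        k₁ , +-cancelʳ-≤ h k₁ h (begin
          k₁ + h   ≤⟨ +-monoʳ-≤ k₁ (from-start h≤D (reverseWalk c→a)) ⟩
          k₁ + k₂  ≤⟨ y→a≤D ⟩
          D        ≤⟨ n≤⌈n/2⌉+⌈n/2⌉ D ⟩
          h + h    ∎) , reverseWalk y→c
      ... | inj₁ _ | inj₂ (k₁ , k₂ , y→c , c→b , refl) =
        k₁ , +-cancelʳ-≤ (D ∸ h) k₁ h (begin
          k₁ + (D ∸ h)  ≤⟨ +-monoʳ-≤ k₁ (to-end h≤D c→b) ⟩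
          k₁ + k₂       ≤⟨ y→b≤D ⟩
          D             ≡⟨ ≡.sym (m+[n∸m]≡n h≤D) ⟩
          h + (D ∸ h)   ∎) , reverseWalk y→c
      ... | inj₁ a-avoid | inj₁ b-avoid = ⊥-elim (geodesic-separates h≤D (reverseʷ a-avoid ++ʷ b-avoid))

  fromList-independent : ∀ {xs} → AllPairs (λ x y → ¬ Adj G x y) xs → Independent G (fromList xs)
  fromList-independent {xs} nonadjacent x y x∈ y∈ x~y
    with AllPairs-∈ nonadjacent (∈-fromList⁻ xs x∈) (∈-fromList⁻ xs y∈)
  ... | inj₁ refl = irref G x~y
  ... | inj₂ (inj₁ x≁y) = x≁y x~y
  ... | inj₂ (inj₂ y≁x) = y≁x (sym G x~y)

  Near : Fin n → Fin n → Set
  Near v x = v ≡ x ⊎ Adj G v x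

  Near⇒Reach : ∀ {v x} → Near v x → Reach 1 v x
  Near⇒Reach (inj₁ refl) = 0 , z≤n , here
  Near⇒Reach (inj₂ v~x) = 1 , ≤-refl , step v~x here

  module _ {D} (γ : Geodesic D) (v : Fin n) where
    open Geodesic γ

    NearOnlyAround : ℕ → Set
    NearOnlyAround t = ∀ i → i ≤ D → i < t ⊎ 3 + t ≤ i → ¬ Near v (vertex i)

    near-only-around : ¬ ¬ (∃ λ t → t ≤ suc D × NearOnlyAround t)
    near-only-around = do
      yes (i , i≤D , near-i) ← ¬¬-excluded-middle {A = ∃ λ i → i ≤ D × Near v (vertex i)}
        where no none → return (suc D , ≤-refl , λ i i≤D _ near-i → none (i , i≤D , near-i))
      (t , (t≤D , near-t) , before) ← ¬¬-least (λ i → i ≤ D × Near v (vertex i)) i (i≤D , near-i)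
      return (t , m≤n⇒m≤1+n t≤D , around t near-t before)
      where
      around : ∀ t → Near v (vertex t) → (∀ j → j < t → ¬ (j ≤ D × Near v (vertex j))) → NearOnlyAround t
      around t near-t before i i≤D (inj₁ i<t) near-i = before i i<t (i≤D , near-i)
      around t near-t before i i≤D (inj₂ 3+t≤i) near-i
        with Reach-trans (Reach-sym (Near⇒Reach near-t)) (Near⇒Reach near-i)
      ... | q , q≤2 , t→i =
        <-irrefl refl (≤-trans (m+n≤o⇒m≤o∸n 3 3+t≤i)
                               (≤-trans (shortest (m+n≤o⇒n≤o 3 3+t≤i) i≤D t→i) q≤2))

    independent-outside-window : ∀ t → t ≤ suc D → NearOnlyAround t →
      ∃ λ S → Independent G S × v ∈ S × ⌈ D /2⌉ ≤ ∣ S ∣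
    independent-outside-window t t≤1+D around =
      fromList V , fromList-independent (AllPairs.map proj₂ V-separated) , ∈-fromList⁺ V (here refl) , V-large
      where
      J = everyOtherOutside t D
      J-range = everyOtherOutside-range t≤1+D
      V = v ∷ map vertex J

      V-separated : AllPairs (λ x y → x ≢ y × ¬ Adj G x y) V
      V-separated =
        All.map⁺ (All.map (λ {i} (i≤D , outside) → (λ v≡ → around i i≤D outside (inj₁ v≡)) ,
                                                     (λ v~ → around i i≤D outside (inj₂ v~))) J-range) ∷
        AllPairs.map⁺ (AllPairs.map (λ (2+i≤j , j≤D , _) → distinct (≤-trans (n≤1+n _) 2+i≤j) j≤D ,
                                                            nonadjacent 2+i≤j j≤D)
                                    (AllPairs-withʳ (everyOtherOutside-spaced {t} {D}) J-range))

      V-large : ⌈ D /2⌉ ≤ ∣ fromList V ∣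
      V-large = begin
        ⌈ D /2⌉                 ≤⟨ ⌈D/2⌉≤1+length-everyOtherOutside t≤1+D ⟩
        suc (length J)          ≡⟨ cong suc (≡.sym (length-map vertex J)) ⟩
        length V                ≤⟨ length≤∣fromList∣ (AllPairs.map proj₁ V-separated) ⟩
        ∣ fromList V ∣          ∎
        where open ≤-Reasoning hiding (start)

    large-independent-set : ¬ ¬ (∃ λ S → Independent G S × v ∈ S × ⌈ D /2⌉ ≤ ∣ S ∣)
    large-independent-set = do
      (t , t≤1+D , around) ← near-only-around
      return (independent-outside-window t t≤1+D around)

theorem8 : ∀ {n : ℕ} (G : Graph n) → Connected G → IsBlockGraph G →
    ∀ (r m : ℕ) → IsRad G r → IsAlphaMin G m → r ≤ m
theorem8 G connected blockGraph r m (_ , radius-least) ((v , _ , α-greatest) , _) = decidable-stable (r ≤? m) do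
  (D , reach , a , b , a-b) ← diametral-pair G connected v
  let γ = IsDist⇒Geodesic G a-b
  (e , e≤ , ecc) ← eccentricity-within G _ ⌈ D /2⌉ (midpoint-reaches G blockGraph γ reach)
  (S , independent , v∈S , S-large) ← large-independent-set G γ v
  return (begin
    r        ≤⟨ radius-least _ e ecc ⟩
    e        ≤⟨ e≤ ⟩
    ⌈ D /2⌉  ≤⟨ S-large ⟩
    ∣ S ∣    ≤⟨ α-greatest S independent v∈S ⟩
    m        ∎)
  where open ≤-Reasoning
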